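{- Let $n\ge1$ and let $X_1,\ldots,X_n,Y_1,\ldots,Y_n$ be algebraically independent indeterminates. Then \[\det_{1\le i,j\le n}\left(X_i^j-Y_i^j\right)=\sum_{\sigma\in\mathcal{S}_n}\operatorname{sgn}(\sigma)\prod_{1\le i\le j\le n}\left(X_{\sigma(j)}-Y_{\sigma(i)}\right).\]
   Context: $\mathcal{S}_n$ denotes the symmetric group on $\{1,\ldots,n\}$. -}

module Defs where

open import Level using (Level)
open import Data.Nat using (ℕ; zero; suc; _≤ᵇ_; _<ᵇ_)
open import Data.Fin using (Fin; zero; suc; toℕ; _≟_)
open import Data.List using (List; []; _∷_; [_]; map; concatMap; foldr; allFin)
open import Data.Bool.ListAction using (and)
open import Data.Bool using (Bool; true; false; if_then_else_; _∨_; not)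
open import Relation.Nullary.Decidable using (⌊_⌋)
open import Algebra.Bundles using (CommutativeRing)

consF : ∀ {m k} → Fin k → (Fin m → Fin k) → (Fin (suc m) → Fin k)
consF a f zero    = a
consF a f (suc i) = f i

allFuns : (m k : ℕ) → List (Fin m → Fin k)
allFuns zero    k = [ (λ ()) ]
allFuns (suc m) k = concatMap (λ a → map (consF a) (allFuns m k)) (allFin k)

isPerm : ∀ {n} → (Fin n → Fin n) → Bool
isPerm {n} σ = and (concatMap (λ i → map (λ j → ⌊ i ≟ j ⌋ ∨ not ⌊ σ i ≟ σ j ⌋) (allFin n)) (allFin n))

count : List Bool → ℕ
count []           = zero
count (true  ∷ bs) = suc (count bs)
count (false ∷ bs) = count bs

inversions : ∀ {n} → (Fin n → Fin n) → ℕ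
inversions {n} σ = count (concatMap (λ i → map (λ j →
  if toℕ i <ᵇ toℕ j then toℕ (σ j) <ᵇ toℕ (σ i) else false) (allFin n)) (allFin n))

module _ {c ℓ : Level} (R : CommutativeRing c ℓ) where
  open CommutativeRing R

  pow : Carrier → ℕ → Carrier
  pow x zero    = 1#
  pow x (suc k) = x * pow x k

  sgn : ∀ {n} → (Fin n → Fin n) → Carrier
  sgn σ = pow (- 1#) (inversions σ)

  sumPerms : ∀ n → ((Fin n → Fin n) → Carrier) → Carrier
  sumPerms n f = foldr (λ σ acc → if isPerm σ then f σ + acc else acc) 0# (allFuns n n)

  prodFin : ∀ n → (Fin n → Carrier) → Carrier
  prodFin n f = foldr (λ i acc → f i * acc) 1# (allFin n)

  det : ∀ n → (Fin n → Fin n → Carrier) → Carrier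
  det n M = sumPerms n (λ σ → sgn σ * prodFin n (λ i → M i (σ i)))

module Submission where

open import Defs
open import Level using (Level)
open import Data.Nat using (ℕ; suc; _≤_; _≤ᵇ_)
open import Data.Fin using (Fin; toℕ)
open import Data.Bool using (if_then_else_)
open import Algebra.Bundles using (CommutativeRing)

open import Algebra.Bundles using (CommutativeMonoid)
open import Data.Bool using (Bool; true; false; not; T; _∧_; _∨_)
open import Data.Bool.ListAction using (and)
open import Data.Bool.Properties using (T-≡)
open import Data.Empty using (⊥-elim)
open import Data.Fin using (zero; suc; fromℕ; fromℕ<; punchIn; punchOut; _≟_)
import Data.Fin.Properties as Finₚ
open import Data.List using (List; []; _∷_; _++_; map; concatMap; foldr; tabulate; allFin)
open import Data.List.Relation.Unary.All using (All; []; _∷_)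
import Data.List.Relation.Unary.All.Properties as Allₚ
open import Data.Maybe using (nothing)
open import Data.Nat as ℕ using (zero; _<ᵇ_; _<?_; _≤?_; z≤n; s≤s)
import Data.Nat.Properties as ℕₚ
open import Data.Nat.Tactic.RingSolver using (solve-∀)
open import Data.Product using (∃; _×_; _,_; proj₁; proj₂)
open import Data.Sum using (_⊎_; inj₁; inj₂)
open import Data.Unit using (tt)
open import Data.Vec.Functional using (insertAt; removeAt)
open import Data.Vec.Functional.Properties using (insertAt-lookup; insertAt-punchIn)
open import Function using (_∘_; Equivalence)
open import Function.Definitions using (Injective)
open import Level using (_⊔_)
open import Relation.Binary.Core using (_Preserves_⟶_)
open import Relation.Binary.PropositionalEquality as ≡ using (_≡_; _≢_; _≗_)
open import Relation.Nullary using (¬_; yes; no; contradiction)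
open import Relation.Nullary.Decidable using (⌊_⌋; dec-true; dec-false)

-- Expanding the determinant along its last column, and the right-hand side
-- according to the value r = σ(n), writes both sides as sums over r of ±1 times a factor times
-- the instance of size n - 1 with X_r, Y_r removed.  On the right the factor is P(X_r), where
-- P(x) = ∏_k (x - Y_k), since the pairs (i, n) contribute ∏_i (X_r - Y_σ(i)).  On the left it is
-- X_r^n - Y_r^n, from the last column x ↦ x^n; replacing x^n by P(x) does not change the
-- determinant, as P(x) - x^n is a combination of 1, x, …, x^(n-1), which give a zero column or
-- repeat an earlier column.  Since P(Y_r) = 0, the two expansions agree.

every-index : ∀ {m} (p i : Fin (suc m)) → i ≡ p ⊎ ∃ λ b → i ≡ punchIn p b
every-index p i with i ≟ p
... | yes i≡p = inj₁ i≡p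
... | no  i≢p = inj₂ (punchOut (i≢p ∘ ≡.sym) , ≡.sym (Finₚ.punchIn-punchOut _))

third-index : ∀ {n} (p q : Fin (suc (suc (suc n)))) → ∃ λ v → v ≢ p × v ≢ q
third-index p q with q ≟ p
... | yes ≡.refl = punchIn p zero , Finₚ.punchInᵢ≢i p zero , Finₚ.punchInᵢ≢i p zero
... | no  q≢p    = punchIn p w , Finₚ.punchInᵢ≢i p w , v≢q
  where
  q′ = punchOut (q≢p ∘ ≡.sym)
  w = punchIn q′ zero
  v≢q : punchIn p w ≢ q
  v≢q eq = Finₚ.punchInᵢ≢i q′ zero
    (Finₚ.punchIn-injective p w q′ (≡.trans eq (≡.sym (Finₚ.punchIn-punchOut _))))

toℕ-punchIn-fromℕ : ∀ {m} (c : Fin m) → toℕ (punchIn (fromℕ m) c) ≡ toℕ c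
toℕ-punchIn-fromℕ {suc m} zero    = ≡.refl
toℕ-punchIn-fromℕ {suc m} (suc c) = ≡.cong suc (toℕ-punchIn-fromℕ c)

consF-cong : ∀ {d K} (a : Fin K) {f f′ : Fin d → Fin K} → f ≗ f′ → consF a f ≗ consF a f′
consF-cong a f≗f′ zero    = ≡.refl
consF-cong a f≗f′ (suc i) = f≗f′ i

insertAt-cong : ∀ {A : Set} {m} {xs ys : Fin m → A} (p : Fin (suc m)) (v : A) →
                xs ≗ ys → insertAt xs p v ≗ insertAt ys p v
insertAt-cong {xs = xs} {ys} p v xs≗ys i with every-index p i
... | inj₁ ≡.refl       = ≡.trans (insertAt-lookup xs p v) (≡.sym (insertAt-lookup ys p v))
... | inj₂ (b , ≡.refl) =
  ≡.trans (insertAt-punchIn xs p v b) (≡.trans (xs≗ys b) (≡.sym (insertAt-punchIn ys p v b)))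

insertAt-noninjective : ∀ {m n} (f : Fin m → Fin n) (p : Fin (suc m)) {v} i → f i ≡ v →
                        ¬ Injective _≡_ _≡_ (insertAt f p v)
insertAt-noninjective f p {v} i fi≡v inj = Finₚ.punchInᵢ≢i p i
  (inj (≡.trans (insertAt-punchIn f p v i) (≡.trans fi≡v (≡.sym (insertAt-lookup f p v)))))

-- Sums over finite sets and over function spaces

module FinSum {a ℓ} (M : CommutativeMonoid a ℓ) where
  open CommutativeMonoid M
  open import Algebra.Properties.CommutativeMonoid.Sum M public
  open import Relation.Binary.Reasoning.Setoid setoid

  sum-cong : ∀ {n} {f g : Fin n → Carrier} → (∀ i → f i ≈ g i) → sum f ≈ sum g
  sum-cong = sum-cong-≋

  sum-zero : ∀ {n} {f : Fin n → Carrier} → (∀ i → f i ≈ ε) → sum f ≈ ε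
  sum-zero {n} f≈ε = trans (sum-cong f≈ε) (sum-replicate-zero n)

  sum-reindex : ∀ {n} {π : Fin n → Fin n} → Injective _≡_ _≡_ π →
                (f : Fin n → Carrier) → sum (f ∘ π) ≈ sum f
  sum-reindex {zero}  _ f = refl
  sum-reindex {suc n} {π} π-inj f = begin
    f (π zero) ∙ sum (f ∘ π ∘ suc)
      ≈⟨ ∙-congˡ (sum-cong (λ i → reflexive (≡.cong f (≡.sym (Finₚ.punchIn-punchOut (π₀≢ i)))))) ⟩
    f (π zero) ∙ sum (removeAt f (π zero) ∘ π′)
      ≈⟨ ∙-congˡ (sum-reindex π′-inj (removeAt f (π zero))) ⟩
    f (π zero) ∙ sum (removeAt f (π zero))
      ≈⟨ sum-remove f ⟨
    sum f ∎
    where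
    π₀≢ : ∀ i → π zero ≢ π (suc i)
    π₀≢ i eq = Finₚ.0≢1+n (π-inj eq)
    π′ : Fin n → Fin n
    π′ i = punchOut (π₀≢ i)
    π′-inj : Injective _≡_ _≡_ π′
    π′-inj eq = Finₚ.suc-injective (π-inj (Finₚ.punchOut-injective (π₀≢ _) (π₀≢ _) eq))

module FunSum {a ℓ} (M : CommutativeMonoid a ℓ) where
  open CommutativeMonoid M
  open FinSum M
  open import Relation.Binary.Reasoning.Setoid setoid

  ∑Fun : ∀ d K → ((Fin d → Fin K) → Carrier) → Carrier
  ∑Fun zero    K g = g (λ ())
  ∑Fun (suc d) K g = sum (λ a → ∑Fun d K (λ f → g (consF a f)))

  ∑Fun-cong : ∀ d K {g h : (Fin d → Fin K) → Carrier} → (∀ f → g f ≈ h f) → ∑Fun d K g ≈ ∑Fun d K h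
  ∑Fun-cong zero    K g≈h = g≈h _
  ∑Fun-cong (suc d) K g≈h = sum-cong {K} (λ a → ∑Fun-cong d K (λ f → g≈h _))

  ∑Fun-zero : ∀ d K {g : (Fin d → Fin K) → Carrier} → (∀ f → g f ≈ ε) → ∑Fun d K g ≈ ε
  ∑Fun-zero zero    K g≈ε = g≈ε _
  ∑Fun-zero (suc d) K g≈ε = sum-zero {K} (λ a → ∑Fun-zero d K (λ f → g≈ε _))

  foldr-allFuns : ∀ d K {g : (Fin d → Fin K) → Carrier} → g Preserves _≗_ ⟶ _≈_ →
                  foldr (λ f acc → g f ∙ acc) ε (allFuns d K) ≈ ∑Fun d K g
  foldr-allFuns zero    K g-resp = trans (identityʳ _) (g-resp (λ ()))
  foldr-allFuns (suc d) K {g} g-resp = trans (foldr-concatMap (λ a → map (consF a) (allFuns d K)) (λ a → a))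
    (sum-cong {K} (λ a → trans (reflexive (foldr-map (consF a) (allFuns d K)))
                                (foldr-allFuns d K (λ f≗f′ → g-resp (consF-cong a f≗f′)))))
    where
    Σg : List (Fin (suc d) → Fin K) → Carrier
    Σg = foldr (λ f acc → g f ∙ acc) ε
    foldr-++ : ∀ fs fs′ → Σg (fs ++ fs′) ≈ Σg fs ∙ Σg fs′
    foldr-++ []       fs′ = sym (identityˡ _)
    foldr-++ (f ∷ fs) fs′ = trans (∙-congˡ (foldr-++ fs fs′)) (sym (assoc _ _ _))
    foldr-map : ∀ {A : Set} (h : A → Fin (suc d) → Fin K) xs →
                Σg (map h xs) ≡ foldr (λ x acc → g (h x) ∙ acc) ε xs
    foldr-map h []       = ≡.refl
    foldr-map h (x ∷ xs) = ≡.cong (g (h x) ∙_) (foldr-map h xs)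
    foldr-concatMap : ∀ {A : Set} (H : A → List (Fin (suc d) → Fin K)) {k} (f : Fin k → A) →
                      Σg (concatMap H (tabulate f)) ≈ sum (Σg ∘ H ∘ f)
    foldr-concatMap H {zero}  f = refl
    foldr-concatMap H {suc k} f = trans (foldr-++ (H (f zero)) _) (∙-congˡ (foldr-concatMap H (f ∘ suc)))

  ∑Fun-insertAt : ∀ d K (p : Fin (suc d)) {g : (Fin (suc d) → Fin K) → Carrier} → g Preserves _≗_ ⟶ _≈_ →
                  ∑Fun (suc d) K g ≈ sum (λ a → ∑Fun d K (λ f → g (insertAt f p a)))
  ∑Fun-insertAt d K zero g-resp =
    sum-cong {K} (λ a → ∑Fun-cong d K (λ f → g-resp (λ { zero → ≡.refl ; (suc i) → ≡.refl })))
  ∑Fun-insertAt (suc d) K (suc p) {g} g-resp = begin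
    sum (λ b → ∑Fun (suc d) K (λ f → g (consF b f)))
      ≈⟨ sum-cong {K} (λ b → ∑Fun-insertAt d K p (λ f≗f′ → g-resp (consF-cong b f≗f′))) ⟩
    sum (λ b → sum (λ a → ∑Fun d K (λ f → g (consF b (insertAt f p a)))))
      ≈⟨ ∑-comm {K} {K} (λ b a → ∑Fun d K (λ f → g (consF b (insertAt f p a)))) ⟩
    sum (λ a → sum (λ b → ∑Fun d K (λ f → g (consF b (insertAt f p a)))))
      ≈⟨ sum-cong {K} (λ a → sum-cong {K} (λ b → ∑Fun-cong d K (λ f →
           g-resp (λ { zero → ≡.refl ; (suc i) → ≡.refl })))) ⟩
    sum (λ a → ∑Fun (suc d) K (λ f → g (insertAt f (suc p) a))) ∎

  ∑Fun-avoid : ∀ d K (v : Fin (suc K)) {g : (Fin d → Fin (suc K)) → Carrier} → g Preserves _≗_ ⟶ _≈_ →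
               (∀ f i → f i ≡ v → g f ≈ ε) → ∑Fun d (suc K) g ≈ ∑Fun d K (λ τ → g (punchIn v ∘ τ))
  ∑Fun-avoid zero    K v g-resp hits = g-resp (λ ())
  ∑Fun-avoid (suc d) K v {g} g-resp hits = begin
    sum (λ a → ∑Fun d (suc K) (λ f → g (consF a f)))
      ≈⟨ sum-remove {i = v} (λ a → ∑Fun d (suc K) (λ f → g (consF a f))) ⟩
    ∑Fun d (suc K) (λ f → g (consF v f)) ∙ sum (λ b → ∑Fun d (suc K) (λ f → g (consF (punchIn v b) f)))
      ≈⟨ ∙-cong (∑Fun-zero d (suc K) (λ f → hits (consF v f) zero ≡.refl))
                (sum-cong {K} (λ b → ∑Fun-avoid d K v (λ f≗f′ → g-resp (consF-cong _ f≗f′))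
                                                    (λ f i fi≡v → hits _ (suc i) fi≡v))) ⟩
    ε ∙ sum (λ b → ∑Fun d K (λ τ → g (consF (punchIn v b) (punchIn v ∘ τ))))
      ≈⟨ identityˡ _ ⟩
    sum (λ b → ∑Fun d K (λ τ → g (consF (punchIn v b) (punchIn v ∘ τ))))
      ≈⟨ sum-cong {K} (λ b → ∑Fun-cong d K (λ τ → g-resp (λ { zero → ≡.refl ; (suc i) → ≡.refl }))) ⟩
    ∑Fun (suc d) K (λ τ → g (punchIn v ∘ τ)) ∎

  ∑Fun-by-preimage : ∀ d K (v : Fin (suc K)) {g : (Fin (suc d) → Fin (suc K)) → Carrier} →
                     g Preserves _≗_ ⟶ _≈_ →
                     (∀ f i j → i ≢ j → f i ≡ v → f j ≡ v → g f ≈ ε) →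
                     (∀ f → (∀ i → f i ≢ v) → g f ≈ ε) →
                     ∑Fun (suc d) (suc K) g ≈ sum (λ p → ∑Fun d K (λ τ → g (insertAt (punchIn v ∘ τ) p v)))
  ∑Fun-by-preimage d K v {g} g-resp twice misses =
    trans (sum-remove {i = v} (λ a → ∑Fun d (suc K) (λ f → g (consF a f))))
          (∙-cong v-first (v-later d g-resp twice misses))
    where
    v-first : ∑Fun d (suc K) (λ f → g (consF v f)) ≈ ∑Fun d K (λ τ → g (insertAt (punchIn v ∘ τ) zero v))
    v-first = trans (∑Fun-avoid d K v (λ f≗f′ → g-resp (consF-cong v f≗f′))
                                     (λ f i fi≡v → twice (consF v f) zero (suc i) (λ ()) ≡.refl fi≡v))
                    (∑Fun-cong d K (λ τ → g-resp (λ { zero → ≡.refl ; (suc i) → ≡.refl })))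
    v-later : ∀ d {g : (Fin (suc d) → Fin (suc K)) → Carrier} → g Preserves _≗_ ⟶ _≈_ →
              (∀ f i j → i ≢ j → f i ≡ v → f j ≡ v → g f ≈ ε) →
              (∀ f → (∀ i → f i ≢ v) → g f ≈ ε) →
              sum (λ b → ∑Fun d (suc K) (λ f → g (consF (punchIn v b) f)))
                ≈ sum (λ p → ∑Fun d K (λ τ → g (insertAt (punchIn v ∘ τ) (suc p) v)))
    v-later zero    g-resp twice misses = sum-zero {K} (λ b → misses _ (λ { zero → Finₚ.punchInᵢ≢i v b }))
    v-later (suc d) {g} g-resp twice misses = begin
      sum (λ b → ∑Fun (suc d) (suc K) (λ f → g (consF (punchIn v b) f)))
        ≈⟨ sum-cong {K} (λ b → ∑Fun-by-preimage d K v (λ f≗f′ → g-resp (consF-cong _ f≗f′))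
             (λ f i j i≢j fi≡v fj≡v → twice _ (suc i) (suc j) (i≢j ∘ Finₚ.suc-injective) fi≡v fj≡v)
             (λ f f-misses → misses _ (λ { zero → Finₚ.punchInᵢ≢i v b ; (suc i) → f-misses i }))) ⟩
      sum (λ b → sum (λ p → ∑Fun d K (λ τ → g (consF (punchIn v b) (insertAt (punchIn v ∘ τ) p v)))))
        ≈⟨ ∑-comm {K} {suc d} (λ b p →
             ∑Fun d K (λ τ → g (consF (punchIn v b) (insertAt (punchIn v ∘ τ) p v)))) ⟩
      sum (λ p → sum (λ b → ∑Fun d K (λ τ → g (consF (punchIn v b) (insertAt (punchIn v ∘ τ) p v)))))
        ≈⟨ sum-cong {suc d} (λ p → sum-cong {K} (λ b → ∑Fun-cong d K
             {λ τ → g (consF (punchIn v b) (insertAt (punchIn v ∘ τ) p v))}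
             {λ τ → g (insertAt (punchIn v ∘ consF b τ) (suc p) v)}
             (λ τ → g-resp (λ { zero → ≡.refl ; (suc i) → ≡.refl })))) ⟩
      sum (λ p → ∑Fun (suc d) K (λ τ → g (insertAt (punchIn v ∘ τ) (suc p) v))) ∎

-- Permutations and inversions

_<ᶠ_ : ∀ {m n} → Fin m → Fin n → Bool
i <ᶠ j = toℕ i <ᵇ toℕ j

<ᶠ-irrefl : ∀ {n} (i : Fin n) → (i <ᶠ i) ≡ false
<ᶠ-irrefl i = dec-false (toℕ i <? toℕ i) (ℕₚ.<-irrefl ≡.refl)

≤ᵇ-true : ∀ {a b} → a ≤ b → (a ≤ᵇ b) ≡ true
≤ᵇ-true {a} {b} = dec-true (a ≤? b)

≤ᵇ-false : ∀ {a b} → ¬ a ≤ b → (a ≤ᵇ b) ≡ false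
≤ᵇ-false {a} {b} = dec-false (a ≤? b)

T-ext : ∀ {x y} → (T x → T y) → (T y → T x) → x ≡ y
T-ext {true}  {true}  _ _ = ≡.refl
T-ext {true}  {false} f _ = ⊥-elim (f tt)
T-ext {false} {true}  _ g = ⊥-elim (g tt)
T-ext {false} {false} _ _ = ≡.refl

T-and⁻ : ∀ bs → T (and bs) → All T bs
T-and⁻ []          _ = []
T-and⁻ (true ∷ bs) t = tt ∷ T-and⁻ bs t

T-and⁺ : ∀ {bs} → All T bs → T (and bs)
T-and⁺ []                = tt
T-and⁺ (_∷_ {true} _ ts) = T-and⁺ ts

allPairs : ∀ {n} → (Fin n → Fin n → Bool) → List Bool
allPairs {n} b = concatMap (λ i → map (b i) (allFin n)) (allFin n)

T-allPairs⁻ : ∀ {n} (b : Fin n → Fin n → Bool) → T (and (allPairs b)) → ∀ i j → T (b i j)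
T-allPairs⁻ b t i j =
  Allₚ.tabulate⁻ (Allₚ.map⁻ (Allₚ.tabulate⁻ (Allₚ.map⁻ (Allₚ.concat⁻ (T-and⁻ (allPairs b) t))) i)) j

T-allPairs⁺ : ∀ {n} (b : Fin n → Fin n → Bool) → (∀ i j → T (b i j)) → T (and (allPairs b))
T-allPairs⁺ b t =
  T-and⁺ (Allₚ.concat⁺ (Allₚ.map⁺ (Allₚ.tabulate⁺ (λ i → Allₚ.map⁺ (Allₚ.tabulate⁺ (t i))))))

isPerm⇒injective : ∀ {n} (σ : Fin n → Fin n) → T (isPerm σ) → Injective _≡_ _≡_ σ
isPerm⇒injective σ t {i} {j} σi≡σj with i ≟ j | σ i ≟ σ j | T-allPairs⁻ _ t i j
... | yes i≡j | _        | _  = i≡j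
... | no _    | no σi≢σj | _  = contradiction σi≡σj σi≢σj
... | no _    | yes _    | ()

injective⇒isPerm : ∀ {n} (σ : Fin n → Fin n) → Injective _≡_ _≡_ σ → T (isPerm σ)
injective⇒isPerm σ σ-inj = T-allPairs⁺ _ entry
  where
  entry : ∀ i j → T (⌊ i ≟ j ⌋ ∨ not ⌊ σ i ≟ σ j ⌋)
  entry i j with i ≟ j | σ i ≟ σ j
  ... | yes _   | _         = tt
  ... | no _    | no _      = tt
  ... | no i≢j  | yes σi≡σj = i≢j (σ-inj σi≡σj)

isPerm-≡ : ∀ {m n} {σ : Fin m → Fin m} {τ : Fin n → Fin n} →
           (Injective _≡_ _≡_ σ → Injective _≡_ _≡_ τ) →
           (Injective _≡_ _≡_ τ → Injective _≡_ _≡_ σ) →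
           isPerm σ ≡ isPerm τ
isPerm-≡ {σ = σ} {τ} σ⇒τ τ⇒σ = T-ext (injective⇒isPerm τ ∘ σ⇒τ ∘ isPerm⇒injective σ)
                                     (injective⇒isPerm σ ∘ τ⇒σ ∘ isPerm⇒injective τ)

isPerm-cong : ∀ {n} {σ τ : Fin n → Fin n} → σ ≗ τ → isPerm σ ≡ isPerm τ
isPerm-cong σ≗τ = isPerm-≡
  (λ σ-inj {i} {j} eq → σ-inj (≡.trans (σ≗τ i) (≡.trans eq (≡.sym (σ≗τ j)))))
  (λ τ-inj {i} {j} eq → τ-inj (≡.trans (≡.sym (σ≗τ i)) (≡.trans eq (σ≗τ j))))

injective⇒surjective : ∀ {n} {σ : Fin n → Fin n} → Injective _≡_ _≡_ σ → ∀ v → ∃ λ i → σ i ≡ v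
injective⇒surjective {suc n} {σ} σ-inj v with Finₚ.any? (λ i → σ i ≟ v)
... | yes hit = hit
... | no miss = contradiction (Finₚ.injective⇒≤ σ′-inj) ℕₚ.1+n≰n
  where
  v≢ : ∀ i → v ≢ σ i
  v≢ i eq = miss (i , ≡.sym eq)
  σ′ : Fin (suc n) → Fin n
  σ′ i = punchOut (v≢ i)
  σ′-inj : Injective _≡_ _≡_ σ′
  σ′-inj eq = σ-inj (Finₚ.punchOut-injective (v≢ _) (v≢ _) eq)

extend : ∀ {m} → Fin (suc m) → Fin (suc m) → (Fin m → Fin m) → Fin (suc m) → Fin (suc m)
extend p v τ = insertAt (punchIn v ∘ τ) p v

extend-at : ∀ {m} (p v : Fin (suc m)) (τ : Fin m → Fin m) → extend p v τ p ≡ v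
extend-at p v τ = insertAt-lookup (punchIn v ∘ τ) p v

extend-punchIn : ∀ {m} (p v : Fin (suc m)) (τ : Fin m → Fin m) b → extend p v τ (punchIn p b) ≡ punchIn v (τ b)
extend-punchIn p v τ = insertAt-punchIn (punchIn v ∘ τ) p v

extend-injective : ∀ {m} (p v : Fin (suc m)) {τ : Fin m → Fin m} →
                   Injective _≡_ _≡_ τ → Injective _≡_ _≡_ (extend p v τ)
extend-injective p v {τ} τ-inj {i} {j} eq with every-index p i | every-index p j
... | inj₁ ≡.refl       | inj₁ ≡.refl       = ≡.refl
... | inj₁ ≡.refl       | inj₂ (c , ≡.refl) = ⊥-elim (Finₚ.punchInᵢ≢i v (τ c)
  (≡.trans (≡.sym (extend-punchIn p v τ c)) (≡.trans (≡.sym eq) (extend-at p v τ))))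
... | inj₂ (b , ≡.refl) | inj₁ ≡.refl       = ⊥-elim (Finₚ.punchInᵢ≢i v (τ b)
  (≡.trans (≡.sym (extend-punchIn p v τ b)) (≡.trans eq (extend-at p v τ))))
... | inj₂ (b , ≡.refl) | inj₂ (c , ≡.refl) = ≡.cong (punchIn p) (τ-inj (Finₚ.punchIn-injective v (τ b) (τ c)
  (≡.trans (≡.sym (extend-punchIn p v τ b)) (≡.trans eq (extend-punchIn p v τ c)))))

extend-injective⁻ : ∀ {m} (p v : Fin (suc m)) {τ : Fin m → Fin m} →
                    Injective _≡_ _≡_ (extend p v τ) → Injective _≡_ _≡_ τ
extend-injective⁻ p v {τ} σ-inj {b} {c} eq = Finₚ.punchIn-injective p b c (σ-inj
  (≡.trans (extend-punchIn p v τ b) (≡.trans (≡.cong (punchIn v) eq) (≡.sym (extend-punchIn p v τ c)))))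

isPerm-extend : ∀ {m} (p v : Fin (suc m)) (τ : Fin m → Fin m) → isPerm (extend p v τ) ≡ isPerm τ
isPerm-extend p v τ = isPerm-≡ (extend-injective⁻ p v) (extend-injective p v)

module _ where
  open import Data.Nat using (_+_)
  open FinSum ℕₚ.+-0-commutativeMonoid

  𝟙 : Bool → ℕ
  𝟙 true  = 1
  𝟙 false = 0

  count-++ : ∀ xs ys → count (xs ++ ys) ≡ count xs + count ys
  count-++ []           ys = ≡.refl
  count-++ (true ∷ xs)  ys = ≡.cong suc (count-++ xs ys)
  count-++ (false ∷ xs) ys = count-++ xs ys

  count-map-tabulate : ∀ {A : Set} {n} (h : A → Bool) (f : Fin n → A) →
                       count (map h (tabulate f)) ≡ sum (𝟙 ∘ h ∘ f)
  count-map-tabulate {n = zero}  h f = ≡.refl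
  count-map-tabulate {n = suc n} h f with h (f zero)
  ... | true  = ≡.cong suc (count-map-tabulate h (f ∘ suc))
  ... | false = count-map-tabulate h (f ∘ suc)

  count-concatMap-tabulate : ∀ {A : Set} {n} (H : A → List Bool) (f : Fin n → A) →
                             count (concatMap H (tabulate f)) ≡ sum (count ∘ H ∘ f)
  count-concatMap-tabulate {n = zero}  H f = ≡.refl
  count-concatMap-tabulate {n = suc n} H f =
    ≡.trans (count-++ (H (f zero)) _) (≡.cong (count (H (f zero)) +_) (count-concatMap-tabulate H (f ∘ suc)))

  count-below : ∀ m t → t ≤ m → sum {m} (λ c → 𝟙 (toℕ c <ᵇ t)) ≡ t
  count-below zero    zero    z≤n       = ≡.refl
  count-below (suc m) zero    _         = sum-zero {suc m} (λ _ → ≡.refl)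
  count-below (suc m) (suc t) (s≤s t≤m) = ≡.cong suc (count-below m t t≤m)

  isInversion : ∀ {n} → (Fin n → Fin n) → Fin n → Fin n → Bool
  isInversion σ i j = if i <ᶠ j then σ j <ᶠ σ i else false

  inversions-sum : ∀ {n} (σ : Fin n → Fin n) → inversions σ ≡ sum (λ i → sum (λ j → 𝟙 (isInversion σ i j)))
  inversions-sum {n} σ =
    ≡.trans (count-concatMap-tabulate (λ i → map (isInversion σ i) (allFin n)) (λ i → i))
            (sum-cong (λ i → count-map-tabulate (isInversion σ i) (λ j → j)))

  inversions-cong : ∀ {n} {σ τ : Fin n → Fin n} → σ ≗ τ → inversions σ ≡ inversions τ
  inversions-cong {σ = σ} {τ} σ≗τ = begin
    inversions σ                                    ≡⟨ inversions-sum σ ⟩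
    sum (λ i → sum (λ j → 𝟙 (isInversion σ i j)))  ≡⟨ sum-cong (λ i → sum-cong (λ j →
        ≡.cong₂ (λ a b → 𝟙 (if i <ᶠ j then a <ᶠ b else false)) (σ≗τ j) (σ≗τ i))) ⟩
    sum (λ i → sum (λ j → 𝟙 (isInversion τ i j)))  ≡⟨ inversions-sum τ ⟨
    inversions τ                                    ∎
    where open ≡.≡-Reasoning

  self-<ᶠ-punchIn : ∀ {m} (p : Fin (suc m)) (c : Fin m) → (p <ᶠ punchIn p c) ≡ not (c <ᶠ p)
  self-<ᶠ-punchIn zero    c       = ≡.refl
  self-<ᶠ-punchIn (suc p) zero    = ≡.refl
  self-<ᶠ-punchIn (suc p) (suc c) = self-<ᶠ-punchIn p c

  punchIn-<ᶠ-self : ∀ {m} (p : Fin (suc m)) (c : Fin m) → (punchIn p c <ᶠ p) ≡ (c <ᶠ p)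
  punchIn-<ᶠ-self zero    c       = ≡.refl
  punchIn-<ᶠ-self (suc p) zero    = ≡.refl
  punchIn-<ᶠ-self (suc p) (suc c) = punchIn-<ᶠ-self p c

  punchIn-<ᶠ-punchIn : ∀ {m} (p : Fin (suc m)) (b c : Fin m) → (punchIn p b <ᶠ punchIn p c) ≡ (b <ᶠ c)
  punchIn-<ᶠ-punchIn zero    b       c       = ≡.refl
  punchIn-<ᶠ-punchIn (suc p) zero    zero    = ≡.refl
  punchIn-<ᶠ-punchIn (suc p) zero    (suc c) = ≡.refl
  punchIn-<ᶠ-punchIn (suc p) (suc b) zero    = ≡.refl
  punchIn-<ᶠ-punchIn (suc p) (suc b) (suc c) = punchIn-<ᶠ-punchIn p b c

  if-false≡∧ : ∀ a b → (if a then b else false) ≡ a ∧ b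
  if-false≡∧ true  b = ≡.refl
  if-false≡∧ false b = ≡.refl

  𝟙-split-left : ∀ a b → 𝟙 (not a ∧ b) + 𝟙 (a ∧ b) ≡ 𝟙 b
  𝟙-split-left true  b = ≡.refl
  𝟙-split-left false b = ℕₚ.+-identityʳ (𝟙 b)

  𝟙-split-right : ∀ a b → 𝟙 (a ∧ not b) + 𝟙 (a ∧ b) ≡ 𝟙 a
  𝟙-split-right true  true  = ≡.refl
  𝟙-split-right true  false = ≡.refl
  𝟙-split-right false b     = ≡.refl

  module _ {m} (p v : Fin (suc m)) (τ : Fin m → Fin m) where
    private
      σ : Fin (suc m) → Fin (suc m)
      σ = extend p v τ
      inv : ∀ {n} → (Fin n → Fin n) → Fin n → Fin n → ℕ
      inv π i j = 𝟙 (isInversion π i j)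
      after-p-below-v : Fin m → ℕ
      after-p-below-v c = 𝟙 (not (c <ᶠ p) ∧ (τ c <ᶠ v))
      before-p-above-v : Fin m → ℕ
      before-p-above-v c = 𝟙 ((c <ᶠ p) ∧ not (τ c <ᶠ v))
      before-p-below-v : Fin m → ℕ
      before-p-below-v c = 𝟙 ((c <ᶠ p) ∧ (τ c <ᶠ v))

    inversions-extend-split :
      inversions σ ≡ sum after-p-below-v + (sum before-p-above-v + inversions τ)
    inversions-extend-split = begin
      inversions σ
        ≡⟨ inversions-sum σ ⟩
      sum (λ i → sum (inv σ i))
        ≡⟨ sum-remove {i = p} (λ i → sum (inv σ i)) ⟩
      sum (inv σ p) + sum (λ b → sum (inv σ (punchIn p b)))
        ≡⟨ ≡.cong₂ _+_ (sum-remove {i = p} (inv σ p))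
                       (sum-cong (λ b → sum-remove {i = p} (inv σ (punchIn p b)))) ⟩
      (inv σ p p + sum (λ c → inv σ p (punchIn p c)))
        + sum (λ b → inv σ (punchIn p b) p + sum (λ c → inv σ (punchIn p b) (punchIn p c)))
        ≡⟨ ≡.cong₂ _+_ (≡.cong₂ _+_ pp (sum-cong pc))
                       (sum-cong (λ b → ≡.cong₂ _+_ (bp b) (sum-cong (bc b)))) ⟩
      sum after-p-below-v + sum (λ b → before-p-above-v b + sum (inv τ b))
        ≡⟨ ≡.cong (sum after-p-below-v +_) (∑-distrib-+ before-p-above-v (λ b → sum (inv τ b))) ⟩
      sum after-p-below-v + (sum before-p-above-v + sum (λ b → sum (inv τ b)))
        ≡⟨ ≡.cong (λ k → sum after-p-below-v + (sum before-p-above-v + k)) (inversions-sum τ) ⟨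
      sum after-p-below-v + (sum before-p-above-v + inversions τ) ∎
      where
      open ≡.≡-Reasoning
      pp : inv σ p p ≡ 0
      pp rewrite <ᶠ-irrefl p = ≡.refl
      pc : ∀ c → inv σ p (punchIn p c) ≡ after-p-below-v c
      pc c rewrite self-<ᶠ-punchIn p c | extend-punchIn p v τ c | extend-at p v τ | punchIn-<ᶠ-self v (τ c)
        = ≡.cong 𝟙 (if-false≡∧ (not (c <ᶠ p)) (τ c <ᶠ v))
      bp : ∀ b → inv σ (punchIn p b) p ≡ before-p-above-v b
      bp b rewrite punchIn-<ᶠ-self p b | extend-punchIn p v τ b | extend-at p v τ | self-<ᶠ-punchIn v (τ b)
        = ≡.cong 𝟙 (if-false≡∧ (b <ᶠ p) (not (τ b <ᶠ v)))
      bc : ∀ b c → inv σ (punchIn p b) (punchIn p c) ≡ inv τ b c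
      bc b c rewrite punchIn-<ᶠ-punchIn p b c | extend-punchIn p v τ b | extend-punchIn p v τ c
                   | punchIn-<ᶠ-punchIn v (τ c) (τ b) = ≡.refl

    inversions-extend : Injective _≡_ _≡_ τ →
                        ∃ λ k → inversions σ + (k + k) ≡ inversions τ + (toℕ p + toℕ v)
    inversions-extend τ-inj = k , (begin
      inversions σ + (k + k)
        ≡⟨ ≡.cong (_+ (k + k)) inversions-extend-split ⟩
      (sum after-p-below-v + (sum before-p-above-v + inversions τ)) + (k + k)
        ≡⟨ shuffle (sum after-p-below-v) (sum before-p-above-v) (inversions τ) k ⟩
      inversions τ + ((sum before-p-above-v + k) + (sum after-p-below-v + k))
        ≡⟨ ≡.cong (inversions τ +_) (≡.cong₂ _+_ before-p≡p below-v≡v) ⟩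
      inversions τ + (toℕ p + toℕ v) ∎)
      where
      open ≡.≡-Reasoning
      k = sum before-p-below-v
      shuffle : ∀ a b i k → (a + (b + i)) + (k + k) ≡ i + ((b + k) + (a + k))
      shuffle = solve-∀
      before-p≡p : sum before-p-above-v + k ≡ toℕ p
      before-p≡p = begin
        sum before-p-above-v + k
          ≡⟨ ∑-distrib-+ before-p-above-v before-p-below-v ⟨
        sum (λ c → before-p-above-v c + before-p-below-v c)
          ≡⟨ sum-cong (λ c → 𝟙-split-right (c <ᶠ p) (τ c <ᶠ v)) ⟩
        sum {m} (λ c → 𝟙 (c <ᶠ p))
          ≡⟨ count-below m (toℕ p) (ℕₚ.≤-pred (Finₚ.toℕ<n p)) ⟩
        toℕ p ∎
      below-v≡v : sum after-p-below-v + k ≡ toℕ v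
      below-v≡v = begin
        sum after-p-below-v + k
          ≡⟨ ∑-distrib-+ after-p-below-v before-p-below-v ⟨
        sum (λ c → after-p-below-v c + before-p-below-v c)
          ≡⟨ sum-cong (λ c → 𝟙-split-left (c <ᶠ p) (τ c <ᶠ v)) ⟩
        sum (λ c → 𝟙 (τ c <ᶠ v))
          ≡⟨ sum-reindex τ-inj (λ x → 𝟙 (x <ᶠ v)) ⟩
        sum {m} (λ c → 𝟙 (c <ᶠ v))
          ≡⟨ count-below m (toℕ v) (ℕₚ.≤-pred (Finₚ.toℕ<n v)) ⟩
        toℕ v ∎

module _ {c ℓ : Level} (R : CommutativeRing c ℓ) where
  open CommutativeRing R hiding (zero)
  open import Algebra.Properties.Ring ring
    using (-1*x≈-x; -‿involutive; -0#≈0#; x[y-z]≈xy-xz; -‿+-comm; //-rightDividesˡ)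
  open import Algebra.Properties.Semiring.Sum semiring using (*-distribˡ-sum)
  open import Algebra.Solver.Ring.NaturalCoefficients commutativeSemiring (λ _ _ → nothing)
  open import Relation.Binary.Reasoning.Setoid setoid
  module Σ = FinSum +-commutativeMonoid
  module Π = FinSum *-commutativeMonoid
  open Σ using (sum)
  open FunSum +-commutativeMonoid

  prod : ∀ {n} → (Fin n → Carrier) → Carrier
  prod = Π.sum

  prodFin≡prod : ∀ n (f : Fin n → Carrier) → prodFin R n f ≡ prod f
  prodFin≡prod n f = go (λ i → i)
    where
    go : ∀ {k} (g : Fin k → Fin n) → foldr (λ i acc → f i * acc) 1# (tabulate g) ≡ prod (f ∘ g)
    go {zero}  g = ≡.refl
    go {suc k} g = ≡.cong (f (g zero) *_) (go (g ∘ suc))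

  prodFin-cong : ∀ n {f g : Fin n → Carrier} → (∀ i → f i ≈ g i) → prodFin R n f ≈ prodFin R n g
  prodFin-cong n {f} {g} f≈g = begin
    prodFin R n f   ≡⟨ prodFin≡prod n f ⟩
    prod f          ≈⟨ Π.sum-cong f≈g ⟩
    prod g          ≡⟨ prodFin≡prod n g ⟨
    prodFin R n g   ∎

  prodFin-remove : ∀ m (p : Fin (suc m)) (f : Fin (suc m) → Carrier) →
                   prodFin R (suc m) f ≈ f p * prodFin R m (f ∘ punchIn p)
  prodFin-remove m p f = begin
    prodFin R (suc m) f                ≡⟨ prodFin≡prod (suc m) f ⟩
    prod f                             ≈⟨ Π.sum-remove {i = p} f ⟩
    f p * prod (f ∘ punchIn p)         ≡⟨ ≡.cong (f p *_) (prodFin≡prod m (f ∘ punchIn p)) ⟨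
    f p * prodFin R m (f ∘ punchIn p)  ∎

  prodFin-ones : ∀ n → prodFin R n (λ _ → 1#) ≈ 1#
  prodFin-ones n = trans (reflexive (prodFin≡prod n (λ _ → 1#))) (Π.sum-zero {n} (λ _ → refl))

  prodFin-* : ∀ n (f g : Fin n → Carrier) → prodFin R n (λ i → f i * g i) ≈ prodFin R n f * prodFin R n g
  prodFin-* n f g = begin
    prodFin R n (λ i → f i * g i)   ≡⟨ prodFin≡prod n _ ⟩
    prod (λ i → f i * g i)          ≈⟨ Π.∑-distrib-+ f g ⟩
    prod f * prod g                 ≡⟨ ≡.cong₂ _*_ (prodFin≡prod n f) (prodFin≡prod n g) ⟨
    prodFin R n f * prodFin R n g   ∎

  prodFin-reindex : ∀ n {π : Fin n → Fin n} → Injective _≡_ _≡_ π → (f : Fin n → Carrier) →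
                    prodFin R n (f ∘ π) ≈ prodFin R n f
  prodFin-reindex n {π} π-inj f = begin
    prodFin R n (f ∘ π)  ≡⟨ prodFin≡prod n (f ∘ π) ⟩
    prod (f ∘ π)         ≈⟨ Π.sum-reindex π-inj f ⟩
    prod f               ≡⟨ prodFin≡prod n f ⟨
    prodFin R n f        ∎

  -- Signs and sums over permutations

  pow-+ : ∀ x a b → pow R x (a ℕ.+ b) ≈ pow R x a * pow R x b
  pow-+ x zero    b = sym (*-identityˡ _)
  pow-+ x (suc a) b = trans (*-congˡ (pow-+ x a b)) (sym (*-assoc _ _ _))

  -1^-even : ∀ k → pow R (- 1#) (k ℕ.+ k) ≈ 1#
  -1^-even zero    = refl
  -1^-even (suc k) = begin
    - 1# * pow R (- 1#) (k ℕ.+ suc k)       ≡⟨ ≡.cong (λ e → - 1# * pow R (- 1#) e) (ℕₚ.+-suc k k) ⟩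
    - 1# * (- 1# * pow R (- 1#) (k ℕ.+ k))  ≈⟨ *-congˡ (*-congˡ (-1^-even k)) ⟩
    - 1# * (- 1# * 1#)                      ≈⟨ *-congˡ (*-identityʳ _) ⟩
    - 1# * - 1#                             ≈⟨ -1*x≈-x _ ⟩
    - - 1#                                  ≈⟨ -‿involutive _ ⟩
    1#                                      ∎

  -1^-parity : ∀ {a b d} k → a ℕ.+ (k ℕ.+ k) ≡ b ℕ.+ d → pow R (- 1#) a ≈ pow R (- 1#) d * pow R (- 1#) b
  -1^-parity {a} {b} {d} k eq = begin
    pow R (- 1#) a                            ≈⟨ *-identityʳ _ ⟨
    pow R (- 1#) a * 1#                       ≈⟨ *-congˡ (-1^-even k) ⟨
    pow R (- 1#) a * pow R (- 1#) (k ℕ.+ k)   ≈⟨ pow-+ (- 1#) a (k ℕ.+ k) ⟨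
    pow R (- 1#) (a ℕ.+ (k ℕ.+ k))            ≡⟨ ≡.cong (pow R (- 1#)) eq ⟩
    pow R (- 1#) (b ℕ.+ d)                    ≈⟨ pow-+ (- 1#) b d ⟩
    pow R (- 1#) b * pow R (- 1#) d           ≈⟨ *-comm _ _ ⟩
    pow R (- 1#) d * pow R (- 1#) b           ∎

  sgn-extend : ∀ {m} (p v : Fin (suc m)) {τ : Fin m → Fin m} → Injective _≡_ _≡_ τ →
               sgn R (extend p v τ) ≈ pow R (- 1#) (toℕ p ℕ.+ toℕ v) * sgn R τ
  sgn-extend p v {τ} τ-inj with inversions-extend p v τ τ-inj
  ... | k , eq = -1^-parity {inversions (extend p v τ)} {inversions τ} k eq

  signed-resp : ∀ {n} {F : (Fin n → Fin n) → Carrier} → F Preserves _≗_ ⟶ _≈_ →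
                (λ σ → sgn R σ * F σ) Preserves _≗_ ⟶ _≈_
  signed-resp F-resp σ≗τ = *-cong (reflexive (≡.cong (pow R (- 1#)) (inversions-cong σ≗τ))) (F-resp σ≗τ)

  sumPerms-cong : ∀ n {f g : (Fin n → Fin n) → Carrier} → (∀ σ → Injective _≡_ _≡_ σ → f σ ≈ g σ) →
                  sumPerms R n f ≈ sumPerms R n g
  sumPerms-cong n {f} {g} f≈g = go (allFuns n n)
    where
    go : ∀ σs → foldr (λ σ acc → if isPerm σ then f σ + acc else acc) 0# σs
              ≈ foldr (λ σ acc → if isPerm σ then g σ + acc else acc) 0# σs
    go []       = refl
    go (σ ∷ σs) with isPerm σ in σ-perm
    ... | true  = +-cong (f≈g σ (isPerm⇒injective σ (Equivalence.from T-≡ σ-perm))) (go σs)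
    ... | false = go σs

  *-distribˡ-sumPerms : ∀ n x (f : (Fin n → Fin n) → Carrier) → x * sumPerms R n f ≈ sumPerms R n (λ σ → x * f σ)
  *-distribˡ-sumPerms n x f = go (allFuns n n)
    where
    go : ∀ σs → x * foldr (λ σ acc → if isPerm σ then f σ + acc else acc) 0# σs
              ≈ foldr (λ σ acc → if isPerm σ then x * f σ + acc else acc) 0# σs
    go []       = zeroʳ x
    go (σ ∷ σs) with isPerm σ
    ... | true  = trans (distribˡ x _ _) (+-congˡ (go σs))
    ... | false = go σs

  onPerms : ∀ {n} → ((Fin n → Fin n) → Carrier) → (Fin n → Fin n) → Carrier
  onPerms g σ = if isPerm σ then g σ else 0#

  onPerms-resp : ∀ {n} {g : (Fin n → Fin n) → Carrier} → g Preserves _≗_ ⟶ _≈_ →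
                 onPerms g Preserves _≗_ ⟶ _≈_
  onPerms-resp g-resp {σ} {τ} σ≗τ rewrite isPerm-cong σ≗τ with isPerm τ
  ... | true  = g-resp σ≗τ
  ... | false = refl

  onPerms-noninjective : ∀ {n} (g : (Fin n → Fin n) → Carrier) {σ} → ¬ Injective _≡_ _≡_ σ → onPerms g σ ≈ 0#
  onPerms-noninjective g {σ} σ-noninj with isPerm σ in σ-perm
  ... | true  = ⊥-elim (σ-noninj (isPerm⇒injective σ (Equivalence.from T-≡ σ-perm)))
  ... | false = refl

  sumPerms≈∑Fun : ∀ n {g : (Fin n → Fin n) → Carrier} → g Preserves _≗_ ⟶ _≈_ →
                  sumPerms R n g ≈ ∑Fun n n (onPerms g)
  sumPerms≈∑Fun n {g} g-resp = trans (go (allFuns n n)) (foldr-allFuns n n (onPerms-resp g-resp))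
    where
    go : ∀ σs → foldr (λ σ acc → if isPerm σ then g σ + acc else acc) 0# σs
              ≈ foldr (λ σ acc → onPerms g σ + acc) 0# σs
    go []       = refl
    go (σ ∷ σs) with isPerm σ
    ... | true  = +-congˡ (go σs)
    ... | false = trans (go σs) (sym (+-identityˡ _))

  ∑Fun-onPerms-extend : ∀ m (p v : Fin (suc m)) {g : (Fin (suc m) → Fin (suc m)) → Carrier} →
                        g Preserves _≗_ ⟶ _≈_ →
                        ∑Fun m m (λ τ → onPerms g (extend p v τ)) ≈ sumPerms R m (λ τ → g (extend p v τ))
  ∑Fun-onPerms-extend m p v {g} g-resp = trans (∑Fun-cong m m restrict)
    (sym (sumPerms≈∑Fun m (λ τ≗τ′ → g-resp (insertAt-cong p v (≡.cong (punchIn v) ∘ τ≗τ′)))))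
    where
    restrict : ∀ τ → onPerms g (extend p v τ) ≈ onPerms (λ τ → g (extend p v τ)) τ
    restrict τ rewrite isPerm-extend p v τ = refl

  sumPerms-by-image : ∀ m (p : Fin (suc m)) {g : (Fin (suc m) → Fin (suc m)) → Carrier} →
                      g Preserves _≗_ ⟶ _≈_ →
                      sumPerms R (suc m) g ≈ sum (λ v → sumPerms R m (λ τ → g (extend p v τ)))
  sumPerms-by-image m p {g} g-resp = begin
    sumPerms R (suc m) g
      ≈⟨ sumPerms≈∑Fun (suc m) g-resp ⟩
    ∑Fun (suc m) (suc m) (onPerms g)
      ≈⟨ ∑Fun-insertAt m (suc m) p (onPerms-resp g-resp) ⟩
    sum (λ v → ∑Fun m (suc m) (λ f → onPerms g (insertAt f p v)))
      ≈⟨ Σ.sum-cong {suc m} (λ v → ∑Fun-avoid m m v (λ f≗f′ → onPerms-resp g-resp (insertAt-cong p v f≗f′))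
           (λ f i fi≡v → onPerms-noninjective g (insertAt-noninjective f p i fi≡v))) ⟩
    sum (λ v → ∑Fun m m (λ τ → onPerms g (extend p v τ)))
      ≈⟨ Σ.sum-cong {suc m} (λ v → ∑Fun-onPerms-extend m p v g-resp) ⟩
    sum (λ v → sumPerms R m (λ τ → g (extend p v τ))) ∎

  sumPerms-by-preimage : ∀ m (v : Fin (suc m)) {g : (Fin (suc m) → Fin (suc m)) → Carrier} →
                         g Preserves _≗_ ⟶ _≈_ →
                         sumPerms R (suc m) g ≈ sum (λ p → sumPerms R m (λ τ → g (extend p v τ)))
  sumPerms-by-preimage m v {g} g-resp = begin
    sumPerms R (suc m) g
      ≈⟨ sumPerms≈∑Fun (suc m) g-resp ⟩
    ∑Fun (suc m) (suc m) (onPerms g)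
      ≈⟨ ∑Fun-by-preimage m m v (onPerms-resp g-resp) twice misses ⟩
    sum (λ p → ∑Fun m m (λ τ → onPerms g (extend p v τ)))
      ≈⟨ Σ.sum-cong {suc m} (λ p → ∑Fun-onPerms-extend m p v g-resp) ⟩
    sum (λ p → sumPerms R m (λ τ → g (extend p v τ))) ∎
    where
    twice : ∀ f i j → i ≢ j → f i ≡ v → f j ≡ v → onPerms g f ≈ 0#
    twice f i j i≢j fi≡v fj≡v = onPerms-noninjective g (λ f-inj → i≢j (f-inj (≡.trans fi≡v (≡.sym fj≡v))))
    misses : ∀ f → (∀ i → f i ≢ v) → onPerms g f ≈ 0#
    misses f f-misses = onPerms-noninjective g (λ f-inj →
      let (i , fi≡v) = injective⇒surjective f-inj v in f-misses i fi≡v)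

  sumPerms-signed-extend : ∀ m (p v : Fin (suc m)) (F : (Fin (suc m) → Fin (suc m)) → Carrier)
                           (G : (Fin m → Fin m) → Carrier) a →
                           (∀ {τ} → Injective _≡_ _≡_ τ → F (extend p v τ) ≈ a * G τ) →
                           sumPerms R m (λ τ → sgn R (extend p v τ) * F (extend p v τ))
                             ≈ pow R (- 1#) (toℕ p ℕ.+ toℕ v) * (a * sumPerms R m (λ τ → sgn R τ * G τ))
  sumPerms-signed-extend m p v F G a F≈aG = begin
    sumPerms R m (λ τ → sgn R (extend p v τ) * F (extend p v τ))
      ≈⟨ sumPerms-cong m (λ τ τ-inj → trans (*-cong (sgn-extend p v τ-inj) (F≈aG τ-inj))
                                             (rearrange s (sgn R τ) a (G τ))) ⟩
    sumPerms R m (λ τ → s * (a * (sgn R τ * G τ)))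
      ≈⟨ trans (*-congˡ (*-distribˡ-sumPerms m a (λ τ → sgn R τ * G τ)))
               (*-distribˡ-sumPerms m s (λ τ → a * (sgn R τ * G τ))) ⟨
    s * (a * sumPerms R m (λ τ → sgn R τ * G τ)) ∎
    where
    s = pow R (- 1#) (toℕ p ℕ.+ toℕ v)
    rearrange : ∀ s t a g → (s * t) * (a * g) ≈ s * (a * (t * g))
    rearrange = solve 4 (λ s t a g → (s :* t) :* (a :* g) := s :* (a :* (t :* g))) refl

  -- Determinants

  minor : ∀ {m} → (Fin (suc m) → Fin (suc m) → Carrier) → Fin (suc m) → Fin (suc m) → Fin m → Fin m → Carrier
  minor M p v i j = M (punchIn p i) (punchIn v j)

  entryProduct : ∀ {n} → (Fin n → Fin n → Carrier) → (Fin n → Fin n) → Carrier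
  entryProduct {n} M σ = prodFin R n (λ i → M i (σ i))

  entryProduct-resp : ∀ {n} (M : Fin n → Fin n → Carrier) → entryProduct M Preserves _≗_ ⟶ _≈_
  entryProduct-resp {n} M σ≗τ = prodFin-cong n (λ i → reflexive (≡.cong (M i) (σ≗τ i)))

  entryProduct-extend : ∀ {m} (M : Fin (suc m) → Fin (suc m) → Carrier) (p v : Fin (suc m)) (τ : Fin m → Fin m) →
                        entryProduct M (extend p v τ) ≈ M p v * entryProduct (minor M p v) τ
  entryProduct-extend {m} M p v τ = trans (prodFin-remove m p (λ i → M i (extend p v τ i)))
    (*-cong (reflexive (≡.cong (M p) (extend-at p v τ)))
            (prodFin-cong m (λ b → reflexive (≡.cong (M (punchIn p b)) (extend-punchIn p v τ b)))))

  det-cong : ∀ n {M N : Fin n → Fin n → Carrier} → (∀ i j → M i j ≈ N i j) → det R n M ≈ det R n N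
  det-cong n M≈N = sumPerms-cong n (λ σ _ → *-congˡ (prodFin-cong n (λ i → M≈N i (σ i))))

  det-expand-column : ∀ m (M : Fin (suc m) → Fin (suc m) → Carrier) (v : Fin (suc m)) →
    det R (suc m) M ≈ sum (λ p → pow R (- 1#) (toℕ p ℕ.+ toℕ v) * (M p v * det R m (minor M p v)))
  det-expand-column m M v =
    trans (sumPerms-by-preimage m v (signed-resp (entryProduct-resp M))) (Σ.sum-cong term)
    where
    term : ∀ p → sumPerms R m (λ τ → sgn R (extend p v τ) * entryProduct M (extend p v τ))
                   ≈ pow R (- 1#) (toℕ p ℕ.+ toℕ v) * (M p v * det R m (minor M p v))
    term p = sumPerms-signed-extend m p v (entryProduct M) (entryProduct (minor M p v)) (M p v)
                                    (λ {τ} _ → entryProduct-extend M p v τ)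

  det₂ : (M : Fin 2 → Fin 2 → Carrier) →
         det R 2 M ≈ M zero zero * M (suc zero) (suc zero) - M zero (suc zero) * M (suc zero) zero
  det₂ M = +-cong (trans (*-identityˡ _) (*-congˡ (*-identityʳ _)))
                  (trans (+-identityʳ _) (trans (*-cong (*-identityʳ (- 1#)) (*-congˡ (*-identityʳ _))) (-1*x≈-x _)))

  Alternating : ℕ → Set (c ⊔ ℓ)
  Alternating n = ∀ (M : Fin n → Fin n → Carrier) {p q} → p ≢ q → (∀ i → M i p ≈ M i q) → det R n M ≈ 0#

  alternating-by-minors : ∀ m → Alternating (suc (suc m)) → Alternating (suc (suc (suc m)))
  alternating-by-minors m minors-alternating M {p} {q} p≢q col =
    trans (det-expand-column (suc (suc m)) M v) (Σ.sum-zero term-vanishes)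
    where
    v = proj₁ (third-index p q)
    v≢p = proj₁ (proj₂ (third-index p q))
    v≢q = proj₂ (proj₂ (third-index p q))
    minor-vanishes : ∀ r → det R (suc (suc m)) (minor M r v) ≈ 0#
    minor-vanishes r = minors-alternating (minor M r v)
      (λ p′≡q′ → p≢q (≡.trans (≡.sym (Finₚ.punchIn-punchOut v≢p))
                              (≡.trans (≡.cong (punchIn v) p′≡q′) (Finₚ.punchIn-punchOut v≢q))))
      (λ i → trans (reflexive (≡.cong (M (punchIn r i)) (Finₚ.punchIn-punchOut v≢p)))
                   (trans (col (punchIn r i)) (reflexive (≡.cong (M (punchIn r i)) (≡.sym (Finₚ.punchIn-punchOut v≢q))))))
    term-vanishes : ∀ r → pow R (- 1#) (toℕ r ℕ.+ toℕ v) * (M r v * det R (suc (suc m)) (minor M r v)) ≈ 0#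
    term-vanishes r = trans (*-congˡ (trans (*-congˡ (minor-vanishes r)) (zeroʳ (M r v)))) (zeroʳ _)

  det-alternating : ∀ m → Alternating (suc m)
  det-alternating zero          M {zero}     {zero}     p≢q _   = contradiction ≡.refl p≢q
  det-alternating (suc zero)    M {zero}     {zero}     p≢q _   = contradiction ≡.refl p≢q
  det-alternating (suc zero)    M {zero}     {suc zero} _   col =
    trans (det₂ M) (trans (+-cong (*-congʳ (col zero)) (-‿cong (*-congˡ (col (suc zero))))) (-‿inverseʳ _))
  det-alternating (suc zero)    M {suc zero} {zero}     _   col =
    trans (det₂ M) (trans (+-cong (*-congˡ (col (suc zero))) (-‿cong (*-congʳ (col zero)))) (-‿inverseʳ _))
  det-alternating (suc zero)    M {suc zero} {suc zero} p≢q _   = contradiction ≡.refl p≢q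
  det-alternating (suc (suc m)) = alternating-by-minors m (det-alternating (suc m))

  -- The right-hand side

  pairFactor : ∀ {n} → (Fin n → Carrier) → (Fin n → Carrier) → (Fin n → Fin n) → Fin n → Fin n → Carrier
  pairFactor X Y σ i j = if toℕ i ≤ᵇ toℕ j then X (σ j) - Y (σ i) else 1#

  pairProduct : ∀ {n} → (Fin n → Carrier) → (Fin n → Carrier) → (Fin n → Fin n) → Carrier
  pairProduct {n} X Y σ = prodFin R n (λ i → prodFin R n (pairFactor X Y σ i))

  rhs : ∀ n → (Fin n → Carrier) → (Fin n → Carrier) → Carrier
  rhs n X Y = sumPerms R n (λ σ → sgn R σ * pairProduct X Y σ)

  pairProduct-resp : ∀ {n} (X Y : Fin n → Carrier) → pairProduct X Y Preserves _≗_ ⟶ _≈_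
  pairProduct-resp {n} X Y σ≗τ = prodFin-cong n (λ i → prodFin-cong n (λ j → reflexive
    (≡.cong₂ (λ a b → if toℕ i ≤ᵇ toℕ j then X a - Y b else 1#) (σ≗τ j) (σ≗τ i))))

  module _ {m} (X Y : Fin (suc m) → Carrier) (r : Fin (suc m)) {τ : Fin m → Fin m} where
    private
      L = fromℕ m
      σ = extend L r τ
      X′ = X ∘ punchIn r
      Y′ = Y ∘ punchIn r

    pairFactor-last-last : pairFactor X Y σ L L ≡ X r - Y r
    pairFactor-last-last rewrite ≤ᵇ-true (ℕₚ.≤-refl {toℕ L}) | extend-at L r τ = ≡.refl

    pairFactor-last-other : ∀ c → pairFactor X Y σ L (punchIn L c) ≡ 1#
    pairFactor-last-other c rewrite Finₚ.toℕ-fromℕ m | toℕ-punchIn-fromℕ c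
                                  | ≤ᵇ-false (ℕₚ.<⇒≱ (Finₚ.toℕ<n c)) = ≡.refl

    pairFactor-other-last : ∀ b → pairFactor X Y σ (punchIn L b) L ≡ X r - Y′ (τ b)
    pairFactor-other-last b rewrite Finₚ.toℕ-fromℕ m | toℕ-punchIn-fromℕ b | ≤ᵇ-true (ℕₚ.<⇒≤ (Finₚ.toℕ<n b))
                                  | extend-at L r τ | extend-punchIn L r τ b = ≡.refl

    pairFactor-other-other : ∀ b c → pairFactor X Y σ (punchIn L b) (punchIn L c) ≡ pairFactor X′ Y′ τ b c
    pairFactor-other-other b c rewrite toℕ-punchIn-fromℕ b | toℕ-punchIn-fromℕ c
                                     | extend-punchIn L r τ b | extend-punchIn L r τ c = ≡.refl

    pairProduct-extend : Injective _≡_ _≡_ τ →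
                         pairProduct X Y σ ≈ prodFin R (suc m) (λ k → X r - Y k) * pairProduct X′ Y′ τ
    pairProduct-extend τ-inj = begin
      prodFin R (suc m) row
        ≈⟨ prodFin-remove m L row ⟩
      row L * prodFin R m (row ∘ punchIn L)
        ≈⟨ *-cong last-row (prodFin-cong m other-row) ⟩
      (X r - Y r) * prodFin R m (λ b → (X r - Y′ (τ b)) * row′ b)
        ≈⟨ *-congˡ (prodFin-* m (λ b → X r - Y′ (τ b)) row′) ⟩
      (X r - Y r) * (prodFin R m (λ b → X r - Y′ (τ b)) * prodFin R m row′)
        ≈⟨ *-congˡ (*-congʳ (prodFin-reindex m τ-inj (λ b → X r - Y′ b))) ⟩
      (X r - Y r) * (prodFin R m (λ b → X r - Y′ b) * prodFin R m row′)
        ≈⟨ *-assoc _ _ _ ⟨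
      ((X r - Y r) * prodFin R m (λ b → X r - Y′ b)) * prodFin R m row′
        ≈⟨ *-congʳ (prodFin-remove m r (λ k → X r - Y k)) ⟨
      prodFin R (suc m) (λ k → X r - Y k) * pairProduct X′ Y′ τ ∎
      where
      row = λ i → prodFin R (suc m) (pairFactor X Y σ i)
      row′ = λ b → prodFin R m (pairFactor X′ Y′ τ b)
      last-row : row L ≈ X r - Y r
      last-row = begin
        row L
          ≈⟨ prodFin-remove m L (pairFactor X Y σ L) ⟩
        pairFactor X Y σ L L * prodFin R m (pairFactor X Y σ L ∘ punchIn L)
          ≈⟨ *-cong (reflexive pairFactor-last-last)
                    (trans (prodFin-cong m (reflexive ∘ pairFactor-last-other)) (prodFin-ones m)) ⟩
        (X r - Y r) * 1#
          ≈⟨ *-identityʳ _ ⟩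
        X r - Y r ∎
      other-row : ∀ b → row (punchIn L b) ≈ (X r - Y′ (τ b)) * row′ b
      other-row b = trans (prodFin-remove m L (pairFactor X Y σ (punchIn L b)))
        (*-cong (reflexive (pairFactor-other-last b)) (prodFin-cong m (reflexive ∘ pairFactor-other-other b)))

  rhs-expand : ∀ m (X Y : Fin (suc m) → Carrier) →
    rhs (suc m) X Y ≈ sum (λ r → pow R (- 1#) (toℕ (fromℕ m) ℕ.+ toℕ r)
                                   * (prodFin R (suc m) (λ k → X r - Y k) * rhs m (X ∘ punchIn r) (Y ∘ punchIn r)))
  rhs-expand m X Y = trans (sumPerms-by-image m (fromℕ m) (signed-resp (pairProduct-resp X Y))) (Σ.sum-cong term)
    where
    term : ∀ r → sumPerms R m (λ τ → sgn R (extend (fromℕ m) r τ) * pairProduct X Y (extend (fromℕ m) r τ))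
                   ≈ pow R (- 1#) (toℕ (fromℕ m) ℕ.+ toℕ r)
                       * (prodFin R (suc m) (λ k → X r - Y k) * rhs m (X ∘ punchIn r) (Y ∘ punchIn r))
    term r = sumPerms-signed-extend m (fromℕ m) r (pairProduct X Y) (pairProduct (X ∘ punchIn r) (Y ∘ punchIn r))
                                    (prodFin R (suc m) (λ k → X r - Y k)) (pairProduct-extend X Y r)

  -- Replacing the last column

  diff-linear : ∀ a b c d z → (a + z * b) - (c + z * d) ≈ (a - c) + z * (b - d)
  diff-linear a b c d z = begin
    (a + z * b) + - (c + z * d)       ≈⟨ +-congˡ (-‿+-comm c (z * d)) ⟨
    (a + z * b) + (- c + - (z * d))   ≈⟨ solve 4 (λ a zb nc nzd → (a :+ zb) :+ (nc :+ nzd) := (a :+ nc) :+ (zb :+ nzd))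
                                               refl a (z * b) (- c) (- (z * d)) ⟩
    (a - c) + (z * b - z * d)         ≈⟨ +-congˡ (x[y-z]≈xy-xz z b d) ⟨
    (a - c) + z * (b - d)             ∎

  powerDiff : ∀ {n} → (Fin n → Carrier) → (Fin n → Carrier) → Fin n → Fin n → Carrier
  powerDiff X Y i j = pow R (X i) (suc (toℕ j)) - pow R (Y i) (suc (toℕ j))

  module LastColumn (m : ℕ) (X Y : Fin (suc m) → Carrier) where
    private
      L = fromℕ m

    powerColumn : Fin m → Carrier → Carrier
    powerColumn c x = pow R x (suc (toℕ c))

    withLastColumn : (Carrier → Carrier) → Fin (suc m) → Fin (suc m) → Carrier
    withLastColumn f i j = insertAt powerColumn L f j (X i) - insertAt powerColumn L f j (Y i)

    minorDet : Fin (suc m) → Carrier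
    minorDet r = det R m (powerDiff (X ∘ punchIn r) (Y ∘ punchIn r))

    Λ-term : (Carrier → Carrier) → Fin (suc m) → Carrier
    Λ-term f r = pow R (- 1#) (toℕ r ℕ.+ toℕ L) * ((f (X r) - f (Y r)) * minorDet r)

    Λ : (Carrier → Carrier) → Carrier
    Λ f = sum (Λ-term f)

    det-withLastColumn : ∀ f → det R (suc m) (withLastColumn f) ≈ Λ f
    det-withLastColumn f = trans (det-expand-column m (withLastColumn f) L) (Σ.sum-cong term)
      where
      column-entries : ∀ {j} {g : Carrier → Carrier} → insertAt powerColumn L f j ≡ g →
                       ∀ i → withLastColumn f i j ≡ g (X i) - g (Y i)
      column-entries eq i = ≡.cong (λ g → g (X i) - g (Y i)) eq
      term : ∀ r → pow R (- 1#) (toℕ r ℕ.+ toℕ L) * (withLastColumn f r L * det R m (minor (withLastColumn f) r L))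
                   ≈ Λ-term f r
      term r = *-congˡ (*-cong (reflexive (column-entries (insertAt-lookup powerColumn L f) r))
        (det-cong m (λ b j → reflexive (column-entries (insertAt-punchIn powerColumn L f j) (punchIn r b)))))

    withLastColumn-pow : ∀ i j → withLastColumn (λ x → pow R x (suc m)) i j ≈ powerDiff X Y i j
    withLastColumn-pow i j = reflexive (≡.cong (λ g → g (X i) - g (Y i)) (column j))
      where
      column : ∀ j → insertAt powerColumn L (λ x → pow R x (suc m)) j ≡ λ x → pow R x (suc (toℕ j))
      column j with every-index L j
      ... | inj₁ ≡.refl       = ≡.trans (insertAt-lookup powerColumn L _)
                                        (≡.cong (λ e x → pow R x (suc e)) (≡.sym (Finₚ.toℕ-fromℕ m)))
      ... | inj₂ (c , ≡.refl) = ≡.trans (insertAt-punchIn powerColumn L _ c)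
                                        (≡.cong (λ e x → pow R x (suc e)) (≡.sym (toℕ-punchIn-fromℕ c)))

    Λ-cong : ∀ {f g} → (∀ x → f x ≈ g x) → Λ f ≈ Λ g
    Λ-cong {f} {g} f≈g = Σ.sum-cong term
      where
      term : ∀ r → Λ-term f r ≈ Λ-term g r
      term r = *-congˡ (*-congʳ (+-cong (f≈g (X r)) (-‿cong (f≈g (Y r)))))

    Λ-linear : ∀ f g z → Λ (λ x → f x + z * g x) ≈ Λ f + z * Λ g
    Λ-linear f g z = begin
      Λ (λ x → f x + z * g x)                  ≈⟨ Σ.sum-cong term ⟩
      sum (λ r → Λ-term f r + z * Λ-term g r)  ≈⟨ Σ.∑-distrib-+ (Λ-term f) (λ r → z * Λ-term g r) ⟩
      Λ f + sum (λ r → z * Λ-term g r)         ≈⟨ +-congˡ (*-distribˡ-sum z (Λ-term g)) ⟨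
      Λ f + z * Λ g                            ∎
      where
      term : ∀ r → Λ-term (λ x → f x + z * g x) r ≈ Λ-term f r + z * Λ-term g r
      term r = trans (*-congˡ (*-congʳ (diff-linear (f (X r)) (g (X r)) (f (Y r)) (g (Y r)) z)))
        (solve 5 (λ s a b z d → s :* ((a :+ z :* b) :* d) := s :* (a :* d) :+ z :* (s :* (b :* d))) refl
               (pow R (- 1#) (toℕ r ℕ.+ toℕ L)) (f (X r) - f (Y r)) (g (X r) - g (Y r)) z (minorDet r))

    Λ-pow-vanishes : ∀ k → k ≤ m → Λ (λ x → pow R x k) ≈ 0#
    Λ-pow-vanishes zero    _   = Σ.sum-zero term
      where
      term : ∀ r → Λ-term (λ _ → 1#) r ≈ 0#
      term r = trans (*-congˡ (trans (*-congʳ (-‿inverseʳ 1#)) (zeroˡ (minorDet r)))) (zeroʳ _)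
    Λ-pow-vanishes (suc k) k<m = trans (sym (det-withLastColumn f))
      (det-alternating m (withLastColumn f) (Finₚ.punchInᵢ≢i L p)
        (λ i → reflexive (≡.cong (λ g → g (X i) - g (Y i)) same-column)))
      where
      f = λ x → pow R x (suc k)
      p = fromℕ< k<m
      same-column : insertAt powerColumn L f (punchIn L p) ≡ insertAt powerColumn L f L
      same-column = ≡.trans (insertAt-punchIn powerColumn L f p)
        (≡.trans (≡.cong (λ e x → pow R x (suc e)) (Finₚ.toℕ-fromℕ< k<m)) (≡.sym (insertAt-lookup powerColumn L f)))

    Λ-power-product : ∀ t (Z : Fin t → Carrier) j → j ℕ.+ t ≤ suc m →
                      Λ (λ x → pow R x j * prod (λ k → x - Z k)) ≈ Λ (λ x → pow R x (j ℕ.+ t))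
    Λ-power-product zero Z j _ =
      Λ-cong (λ x → trans (*-identityʳ _) (reflexive (≡.cong (pow R x) (≡.sym (ℕₚ.+-identityʳ j)))))
    Λ-power-product (suc t) Z j j+t≤m+1 = begin
      Λ (λ x → pow R x j * ((x - z) * Q x))
        ≈⟨ +-identityʳ _ ⟨
      Λ (λ x → pow R x j * ((x - z) * Q x)) + 0#
        ≈⟨ +-congˡ (trans (*-congˡ lower-vanishes) (zeroʳ z)) ⟨
      Λ (λ x → pow R x j * ((x - z) * Q x)) + z * Λ (λ x → pow R x j * Q x)
        ≈⟨ Λ-linear (λ x → pow R x j * ((x - z) * Q x)) (λ x → pow R x j * Q x) z ⟨
      Λ (λ x → pow R x j * ((x - z) * Q x) + z * (pow R x j * Q x))
        ≈⟨ Λ-cong (λ x → absorb x (pow R x j) (Q x)) ⟩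
      Λ (λ x → pow R x (suc j) * Q x)
        ≈⟨ Λ-power-product t (Z ∘ suc) (suc j) 1+j+t≤m+1 ⟩
      Λ (λ x → pow R x (suc j ℕ.+ t))
        ≈⟨ Λ-cong (λ x → reflexive (≡.cong (pow R x) (≡.sym (ℕₚ.+-suc j t)))) ⟩
      Λ (λ x → pow R x (j ℕ.+ suc t)) ∎
      where
      z = Z zero
      Q : Carrier → Carrier
      Q x = prod (λ k → x - Z (suc k))
      1+j+t≤m+1 : suc j ℕ.+ t ≤ suc m
      1+j+t≤m+1 = ℕₚ.≤-trans (ℕₚ.≤-reflexive (≡.sym (ℕₚ.+-suc j t))) j+t≤m+1
      j+t≤m : j ℕ.+ t ≤ m
      j+t≤m = ℕₚ.≤-pred 1+j+t≤m+1
      lower-vanishes : Λ (λ x → pow R x j * Q x) ≈ 0#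
      lower-vanishes = trans (Λ-power-product t (Z ∘ suc) j (ℕₚ.m≤n⇒m≤1+n j+t≤m))
                             (Λ-pow-vanishes (j ℕ.+ t) j+t≤m)
      absorb : ∀ x p q → p * ((x - z) * q) + z * (p * q) ≈ (x * p) * q
      absorb x p q = begin
        p * ((x - z) * q) + z * (p * q)
          ≈⟨ solve 4 (λ p w z q → p :* (w :* q) :+ z :* (p :* q) := (w :+ z) :* (p :* q)) refl p (x - z) z q ⟩
        ((x - z) + z) * (p * q)  ≈⟨ *-congʳ (//-rightDividesˡ z x) ⟩
        x * (p * q)              ≈⟨ *-assoc x p q ⟨
        (x * p) * q              ∎

    det≈rhs-step : (∀ r → minorDet r ≈ rhs m (X ∘ punchIn r) (Y ∘ punchIn r)) →
                   det R (suc m) (powerDiff X Y) ≈ rhs (suc m) X Y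
    det≈rhs-step minors = begin
      det R (suc m) (powerDiff X Y)                           ≈⟨ det-cong (suc m) withLastColumn-pow ⟨
      det R (suc m) (withLastColumn (λ x → pow R x (suc m)))  ≈⟨ det-withLastColumn _ ⟩
      Λ (λ x → pow R x (suc m))                               ≈⟨ Λ-power-product (suc m) Y 0 ℕₚ.≤-refl ⟨
      Λ (λ x → 1# * prod (λ k → x - Y k))                     ≈⟨ Σ.sum-cong term ⟩
      sum (λ r → pow R (- 1#) (toℕ L ℕ.+ toℕ r) * (P r * rhs m (X ∘ punchIn r) (Y ∘ punchIn r)))
                                                              ≈⟨ rhs-expand m X Y ⟨
      rhs (suc m) X Y                                         ∎
      where
      P : Fin (suc m) → Carrier
      P r = prodFin R (suc m) (λ k → X r - Y k)
      Y-root : ∀ r → 1# * prod (λ k → Y r - Y k) ≈ 0#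
      Y-root r = trans (*-identityˡ _)
        (trans (Π.sum-remove {i = r} (λ k → Y r - Y k)) (trans (*-congʳ (-‿inverseʳ (Y r))) (zeroˡ _)))
      X-value : ∀ r → 1# * prod (λ k → X r - Y k) - 1# * prod (λ k → Y r - Y k) ≈ P r
      X-value r = trans (+-congˡ (trans (-‿cong (Y-root r)) -0#≈0#))
        (trans (+-identityʳ _) (trans (*-identityˡ _) (reflexive (≡.sym (prodFin≡prod (suc m) (λ k → X r - Y k))))))
      term : ∀ r → Λ-term (λ x → 1# * prod (λ k → x - Y k)) r
                     ≈ pow R (- 1#) (toℕ L ℕ.+ toℕ r) * (P r * rhs m (X ∘ punchIn r) (Y ∘ punchIn r))
      term r = *-cong (reflexive (≡.cong (pow R (- 1#)) (ℕₚ.+-comm (toℕ r) (toℕ L)))) (*-cong (X-value r) (minors r))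

  det≈rhs : ∀ n (X Y : Fin n → Carrier) → det R n (powerDiff X Y) ≈ rhs n X Y
  det≈rhs zero    X Y = refl
  det≈rhs (suc m) X Y = LastColumn.det≈rhs-step m X Y (λ r → det≈rhs m (X ∘ punchIn r) (Y ∘ punchIn r))

lemma7p1 : {c ℓ : Level} (R : CommutativeRing c ℓ) (n : ℕ) → 1 ≤ n →
    (X Y : Fin n → CommutativeRing.Carrier R) →
    let open CommutativeRing R in
    det R n (λ i j → pow R (X i) (suc (toℕ j)) - pow R (Y i) (suc (toℕ j)))
      ≈ sumPerms R n (λ σ → sgn R σ *
          prodFin R n (λ i → prodFin R n (λ j →
            if toℕ i ≤ᵇ toℕ j then X (σ j) - Y (σ i) else 1#)))
lemma7p1 R n _ = det≈rhs R n
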